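{- Let $p=p_n$ be an odd prime ($n\ge 2$). The following two conditions are equivalent: (1) every integer $k$ with $\frac{p_n+1}{2}\le k\le \frac{p_{n+1}-1}{2}$ is composite; (2) there is an index $m\ge 1$ with $p_m<p/2<p_{m+1}$, and for this $m$ the open interval $(p,\,2p_{m+1})$ contains a prime.
   Context: $p_1=2<p_2=3<p_3=5<\dots$ denotes the sequence of all primes, $p_j$ being the $j$-th prime. -}

module Defs where

open import Data.Nat using (ℕ; suc; _<_)
open import Data.Nat.Primality using (Prime)
open import Data.Product using (_×_)
open import Relation.Nullary using (¬_)

-- IsNthPrime j p : p is the j-th prime p_j (1-indexed: p_1 = 2, p_2 = 3, ...).
data IsNthPrime : ℕ → ℕ → Set where
  first : IsNthPrime 1 2
  next  : ∀ {j p q} → IsNthPrime j p → Prime q → p < q →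
          (∀ r → p < r → r < q → ¬ Prime r) → IsNthPrime (suc j) q

{-# OPTIONS --safe #-}
module Submission where

-- As p and q are odd, the k in question are exactly those with p < 2k < q.  Walking down
-- the enumeration from p > 3 gives consecutive primes a < b with 2a < p < 2b.  A prime k with
-- p < 2k < q exceeds a, hence k ≥ b, so a prime r in (p, 2b) would lie strictly between the
-- consecutive primes p and q.  Conversely, if no such k is prime then b is not one, which
-- forces q < 2b, and r = q will do.

open import Defs
open import Data.Nat
  using (ℕ; suc; _+_; _*_; _∸_; _≤_; _<_; _≥_; z≤n; s≤s; s≤s⁻¹; _<?_; nonTrivial⇒n>1; n>1⇒nonTrivial)
open import Data.Nat.Properties
open import Data.Nat.DivMod using (_/_; m*n/n≡m; m/n*n≤m; /-monoˡ-≤; m<n*o⇒m/o<n)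
open import Data.Nat.Divisibility using (divides)
open import Data.Nat.Primality
  using (Prime; Composite; composite; prime[2]; prime⇒nonTrivial; composite⇒¬prime; ¬prime⇒composite)
open import Data.Product using (_×_; ∃-syntax; _,_; proj₁; proj₂)
open import Function.Bundles using (_⇔_; mk⇔; Equivalence)
open import Function.Construct.Composition using (_⇔-∘_)
open import Relation.Nullary using (¬_; yes; no; contradiction)
open import Relation.Unary using (Pred; Decidable)
open import Relation.Binary.Definitions using (tri<; tri≈; tri>)
open import Relation.Binary.PropositionalEquality using (_≡_; _≢_; refl; sym; subst)

Odd : ℕ → Set
Odd n = ∀ k → n ≢ 2 * k

Odd⇒≤2*⇒<2* : ∀ {n} k → Odd n → n ≤ 2 * k → n < 2 * k
Odd⇒≤2*⇒<2* k odd n≤2k = ≤∧≢⇒< n≤2k (odd k)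

Odd⇒2*≤⇒2*< : ∀ {n} k → Odd n → 2 * k ≤ n → 2 * k < n
Odd⇒2*≤⇒2*< k odd 2k≤n = ≤∧≢⇒< 2k≤n (λ 2k≡n → odd k (sym 2k≡n))

prime⇒1< : ∀ {p} → Prime p → 1 < p
prime⇒1< {p} P = nonTrivial⇒n>1 p {{prime⇒nonTrivial P}}

prime∧2<⇒Odd : ∀ {p} → Prime p → 2 < p → Odd p
prime∧2<⇒Odd P 2<p k p≡2k =
  Prime.notComposite P (composite 2<p (divides k (subst (_≡ k * 2) (sym p≡2k) (*-comm 2 k))))

2*m≤n⇒m≤n/2 : ∀ {m n} → 2 * m ≤ n → m ≤ n / 2
2*m≤n⇒m≤n/2 {m} {n} 2m≤n =
  subst (_≤ n / 2) (m*n/n≡m m 2) (/-monoˡ-≤ 2 (subst (_≤ n) (*-comm 2 m) 2m≤n))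

m≤n/2⇒2*m≤n : ∀ {m n} → m ≤ n / 2 → 2 * m ≤ n
m≤n/2⇒2*m≤n {m} {n} m≤n/2 =
  ≤-trans (*-monoʳ-≤ 2 m≤n/2) (subst (_≤ n) (*-comm (n / 2) 2) (m/n*n≤m n 2))

n≤1+2*m⇒n/2≤m : ∀ {m n} → n ≤ suc (2 * m) → n / 2 ≤ m
n≤1+2*m⇒n/2≤m {m} {n} n≤1+2m =
  s≤s⁻¹ (m<n*o⇒m/o<n (subst (λ x → n < suc (suc x)) (*-comm 2 m) (s≤s n≤1+2m)))

n/2≤m⇒n≤1+2*m : ∀ {m n} → n / 2 ≤ m → n ≤ suc (2 * m)
n/2≤m⇒n≤1+2*m {m} {n} n/2≤m =
  ≮⇒≥ (λ 2+2m≤n → ≤⇒≯ n/2≤m (2*m≤n⇒m≤n/2 (subst (_≤ n) (sym (*-suc 2 m)) 2+2m≤n)))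

[p+1]/2≤k⇔p<2*k : ∀ {p k} → Odd p → (p + 1) / 2 ≤ k ⇔ p < 2 * k
[p+1]/2≤k⇔p<2*k {p} {k} odd = mk⇔
  (λ bound → Odd⇒≤2*⇒<2* k odd (s≤s⁻¹ (subst (_≤ suc (2 * k)) (+-comm p 1) (n/2≤m⇒n≤1+2*m bound))))
  (λ p<2k → n≤1+2*m⇒n/2≤m (subst (_≤ suc (2 * k)) (+-comm 1 p) (m<n⇒m<1+n p<2k)))

k≤[q∸1]/2⇔2*k<q : ∀ {q k} → 0 < q → k ≤ (q ∸ 1) / 2 ⇔ 2 * k < q
k≤[q∸1]/2⇔2*k<q {suc q} _ = mk⇔ (λ bound → s≤s (m≤n/2⇒2*m≤n bound)) (λ 2k<q → 2*m≤n⇒m≤n/2 (s≤s⁻¹ 2k<q))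

NoPrimeIn : ℕ → ℕ → Set
NoPrimeIn a b = ∀ r → a < r → r < b → ¬ Prime r

IsNthPrime⇒Prime : ∀ {j p} → IsNthPrime j p → Prime p
IsNthPrime⇒Prime first = prime[2]
IsNthPrime⇒Prime (next _ P _ _) = P

IsNthPrime⇒index≥1 : ∀ {j p} → IsNthPrime j p → j ≥ 1
IsNthPrime⇒index≥1 first = s≤s z≤n
IsNthPrime⇒index≥1 (next _ _ _ _) = s≤s z≤n

IsNthPrime-index≥2⇒2< : ∀ {j p} → j ≥ 2 → IsNthPrime j p → 2 < p
IsNthPrime-index≥2⇒2< (s≤s (s≤s z≤n)) (next h _ x<p _) =
  ≤-<-trans (prime⇒1< (IsNthPrime⇒Prime h)) x<p

IsNthPrime-functional : ∀ {j p p′} → IsNthPrime j p → IsNthPrime j p′ → p ≡ p′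
IsNthPrime-functional first first = refl
IsNthPrime-functional (next h P x<p gap) (next h′ P′ x′<p′ gap′)
  with refl ← IsNthPrime-functional h h′ with <-cmp _ _
... | tri< p<p′ _ _ = contradiction P (gap′ _ x<p p<p′)
... | tri≈ _ p≡p′ _ = p≡p′
... | tri> _ _ p′<p = contradiction P′ (gap _ x′<p′ p′<p)

IsNthPrime-suc⇒gap : ∀ {j a b} → IsNthPrime j a → IsNthPrime (suc j) b → a < b × NoPrimeIn a b
IsNthPrime-suc⇒gap ha (next h _ x<b gap) with refl ← IsNthPrime-functional h ha = x<b , gap

IsNthPrime-crossing : ∀ {ℓ} {P : Pred ℕ ℓ} → Decidable P → ∀ {j y} → IsNthPrime j y → P 2 → ¬ P y →
  ∃[ m ] ∃[ a ] ∃[ b ] (IsNthPrime m a × IsNthPrime (suc m) b × P a × ¬ P b)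
IsNthPrime-crossing P? first P2 ¬P2 = contradiction P2 ¬P2
IsNthPrime-crossing P? (next {j} {x} h Py x<y gap) P2 ¬Py with P? x
... | yes Px = j , x , _ , h , next h Py x<y gap , Px , ¬Py
... | no ¬Px = IsNthPrime-crossing P? h P2 ¬Px

module ConsecutivePrimes {n p q : ℕ} (n≥2 : n ≥ 2) (hp : IsNthPrime n p) (hq : IsNthPrime (suc n) q) where

  Pp : Prime p
  Pp = IsNthPrime⇒Prime hp

  Pq : Prime q
  Pq = IsNthPrime⇒Prime hq

  2<p : 2 < p
  2<p = IsNthPrime-index≥2⇒2< n≥2 hp

  p<q : p < q
  p<q = proj₁ (IsNthPrime-suc⇒gap hp hq)

  gap : NoPrimeIn p q
  gap = proj₂ (IsNthPrime-suc⇒gap hp hq)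

  NoPrimeBetweenHalves : Set
  NoPrimeBetweenHalves = ∀ k → p < 2 * k → 2 * k < q → ¬ Prime k

  Crossing : Set
  Crossing = ∃[ m ] ∃[ a ] ∃[ b ] (m ≥ 1 × IsNthPrime m a × IsNthPrime (suc m) b
               × 2 * a < p × p < 2 * b
               × ∃[ r ] (Prime r × p < r × r < 2 * b))

  oddP : Odd p
  oddP = prime∧2<⇒Odd Pp 2<p

  oddQ : Odd q
  oddQ = prime∧2<⇒Odd Pq (<-trans 2<p p<q)

  compositeRange⇔NoPrimeBetweenHalves :
    (∀ k → (p + 1) / 2 ≤ k → k ≤ (q ∸ 1) / 2 → Composite k) ⇔ NoPrimeBetweenHalves
  compositeRange⇔NoPrimeBetweenHalves = mk⇔
    (λ H k p<2k 2k<q → composite⇒¬prime (H k (from lower p<2k) (from (upper k) 2k<q)))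
    (λ H k l u → ¬prime⇒composite {{n>1⇒nonTrivial (1<k (to lower l))}}
                                   (H k (to lower l) (to (upper k) u)))
    where
      open Equivalence
      lower : ∀ {k} → (p + 1) / 2 ≤ k ⇔ p < 2 * k
      lower = [p+1]/2≤k⇔p<2*k oddP
      upper : ∀ k → k ≤ (q ∸ 1) / 2 ⇔ 2 * k < q
      upper k = k≤[q∸1]/2⇔2*k<q (≤-<-trans z≤n p<q)
      1<k : ∀ {k} → p < 2 * k → 1 < k
      1<k p<2k = *-cancelˡ-< 2 1 _ (<-trans 2<p p<2k)

  NoPrimeBetweenHalves⇒Crossing : NoPrimeBetweenHalves → Crossing
  NoPrimeBetweenHalves⇒Crossing H with 4 <? p
  -- p = 3, and the prime 2 lies between 3/2 and q/2
  ... | no 4≮p = contradiction prime[2] (H 2 p<4 4<q)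
    where
      p<4 : p < 2 * 2
      p<4 = Odd⇒≤2*⇒<2* 2 oddP (≮⇒≥ 4≮p)
      4<q : 2 * 2 < q
      4<q = Odd⇒2*≤⇒2*< 2 oddQ (≤-trans (s≤s 2<p) p<q)
  ... | yes 4<p with IsNthPrime-crossing (λ x → 2 * x <? p) hp 4<p (λ 2p<p → <⇒≱ 2p<p (m≤m+n p _))
  ...   | m , a , b , ha , hb , 2a<p , 2b≮p =
    m , a , b , IsNthPrime⇒index≥1 ha , ha , hb , 2a<p , p<2b , q , Pq , p<q , q<2b
    where
      p<2b : p < 2 * b
      p<2b = Odd⇒≤2*⇒<2* b oddP (≮⇒≥ 2b≮p)
      q<2b : q < 2 * b
      q<2b = ≰⇒> (λ 2b≤q → H b p<2b (Odd⇒2*≤⇒2*< b oddQ 2b≤q) (IsNthPrime⇒Prime hb))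

  Crossing⇒NoPrimeBetweenHalves : Crossing → NoPrimeBetweenHalves
  Crossing⇒NoPrimeBetweenHalves (m , a , b , _ , ha , hb , 2a<p , p<2b , r , Pr , p<r , r<2b) k p<2k 2k<q Pk =
    gap r p<r (<-≤-trans r<2b (≤-trans (*-monoʳ-≤ 2 b≤k) (<⇒≤ 2k<q))) Pr
    where
      a<k : a < k
      a<k = *-cancelˡ-< 2 a k (<-trans 2a<p p<2k)
      b≤k : b ≤ k
      b≤k = ≮⇒≥ (λ k<b → proj₂ (IsNthPrime-suc⇒gap ha hb) k a<k k<b Pk)

lemma1 : ∀ (n p q : ℕ) → n ≥ 2 → IsNthPrime n p → IsNthPrime (suc n) q →
    ((∀ k → (p + 1) / 2 ≤ k → k ≤ (q ∸ 1) / 2 → Composite k)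
      ⇔
     (∃[ m ] ∃[ a ] ∃[ b ] (m ≥ 1 × IsNthPrime m a × IsNthPrime (suc m) b
        × 2 * a < p × p < 2 * b
        × ∃[ r ] (Prime r × p < r × r < 2 * b))))
lemma1 n p q n≥2 hp hq =
  mk⇔ NoPrimeBetweenHalves⇒Crossing Crossing⇒NoPrimeBetweenHalves ⇔-∘ compositeRange⇔NoPrimeBetweenHalves
  where open ConsecutivePrimes n≥2 hp hq
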